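{- Let $R$ be a dp-minimal integral domain. Then $R$ is divided. In particular, there exists $N\in\mathbb{N}$ such that for all $a,b$ in the maximal ideal of $R$, either $a\in\langle b\rangle$ or $b^N\in\langle a\rangle$.
   Context: Rings are commutative with identity; a dp-minimal integral domain is an integral domain $R$ such that the structure $(R;+,\cdot,0,1)$ is dp-minimal. Such a ring is local, i.e. has a unique maximal ideal. $\langle a\rangle = aR$ denotes the principal ideal generated by $a$. A prime ideal $\mathfrak p$ of a ring $R$ is called divided if for every $a\in R$ either $\mathfrak p\subseteq\langle a\rangle$ or $\langle a\rangle\subseteq \mathfrak p$ (equivalently $\mathfrak p=\mathfrak pR_{\mathfrak p}$). A ring is divided if every prime ideal of it is divided. -}

module Defs where

open import Level using (Level; _⊔_)
open import Algebra.Bundles using (CommutativeRing)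
open import Data.Nat using (ℕ; zero; suc)
open import Data.Fin using (Fin)
open import Data.Vec using (Vec; []; _∷_; lookup)
open import Data.Product using (Σ; Σ-syntax; ∃; _×_; _,_)
open import Data.Sum using (_⊎_)
open import Data.Empty using (⊥)
open import Data.Empty.Polymorphic renaming (⊥ to ⊥ℓ)
open import Relation.Nullary using (¬_)
open import Relation.Binary.PropositionalEquality using (_≡_)
open import Function.Bundles using (_⇔_)

data Term (n : ℕ) : Set where
  var  : Fin n → Term n
  `0   : Term n
  `1   : Term n
  _`+_ : Term n → Term n → Term n
  _`*_ : Term n → Term n → Term n

data Formula : ℕ → Set where
  _`≈_ : ∀ {n} → Term n → Term n → Formula n
  `⊥   : ∀ {n} → Formula n
  _`∧_ : ∀ {n} → Formula n → Formula n → Formula n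
  _`∨_ : ∀ {n} → Formula n → Formula n → Formula n
  _`⇒_ : ∀ {n} → Formula n → Formula n → Formula n
  `∀   : ∀ {n} → Formula (suc n) → Formula n
  `∃   : ∀ {n} → Formula (suc n) → Formula n

module _ {c ℓ : Level} (R : CommutativeRing c ℓ) where
  open CommutativeRing R

  ⟦_⟧ᵗ : ∀ {n} → Term n → Vec Carrier n → Carrier
  ⟦ var i ⟧ᵗ ρ = lookup ρ i
  ⟦ `0 ⟧ᵗ ρ = 0#
  ⟦ `1 ⟧ᵗ ρ = 1#
  ⟦ s `+ t ⟧ᵗ ρ = ⟦ s ⟧ᵗ ρ + ⟦ t ⟧ᵗ ρ
  ⟦ s `* t ⟧ᵗ ρ = ⟦ s ⟧ᵗ ρ * ⟦ t ⟧ᵗ ρ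

  Sat : ∀ {n} → Formula n → Vec Carrier n → Set (c ⊔ ℓ)
  Sat (s `≈ t) ρ = Level.Lift c (⟦ s ⟧ᵗ ρ ≈ ⟦ t ⟧ᵗ ρ)
  Sat `⊥ ρ = ⊥ℓ
  Sat (φ `∧ ψ) ρ = Sat φ ρ × Sat ψ ρ
  Sat (φ `∨ ψ) ρ = Sat φ ρ ⊎ Sat ψ ρ
  Sat (φ `⇒ ψ) ρ = Sat φ ρ → Sat ψ ρ
  Sat (`∀ φ) ρ = (x : Carrier) → Sat φ (x ∷ ρ)
  Sat (`∃ φ) ρ = Σ[ x ∈ Carrier ] Sat φ (x ∷ ρ)

  -- An ict-pattern of depth 2 in one object variable (variable 0 = x,
  -- the remaining variables are the parameter tuples), given in its
  -- finite form: for every n, rows a₀..a_{n-1}, b₀..b_{n-1} realised in R.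
  ICTPattern2 : Set (c ⊔ ℓ)
  ICTPattern2 =
    Σ[ k ∈ ℕ ] Σ[ m ∈ ℕ ] Σ[ φ ∈ Formula (suc k) ] Σ[ ψ ∈ Formula (suc m) ]
      ((n : ℕ) →
        Σ[ a ∈ (Fin n → Vec Carrier k) ] Σ[ b ∈ (Fin n → Vec Carrier m) ]
          ((i j : Fin n) → Σ[ x ∈ Carrier ]
             (((i' : Fin n) → Sat φ (x ∷ a i') ⇔ (i' ≡ i)) ×
              ((j' : Fin n) → Sat ψ (x ∷ b j') ⇔ (j' ≡ j)))))

  DpMinimal : Set (c ⊔ ℓ)
  DpMinimal = ¬ ICTPattern2

  IsIntegralDomain : Set (c ⊔ ℓ)
  IsIntegralDomain =
    (¬ (1# ≈ 0#)) × (∀ a b → a * b ≈ 0# → a ≈ 0# ⊎ b ≈ 0#)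

  Pred : Set (Level.suc (c ⊔ ℓ))
  Pred = Carrier → Set (c ⊔ ℓ)

  _⊆_ : Pred → Pred → Set (c ⊔ ℓ)
  P ⊆ Q = ∀ x → P x → Q x

  IsIdeal : Pred → Set (c ⊔ ℓ)
  IsIdeal I =
    (∀ x y → x ≈ y → I x → I y) ×
    I 0# ×
    (∀ x y → I x → I y → I (x + y)) ×
    (∀ r x → I x → I (r * x))

  IsPrimeIdeal : Pred → Set (c ⊔ ℓ)
  IsPrimeIdeal P =
    IsIdeal P × (¬ P 1#) × (∀ a b → P (a * b) → P a ⊎ P b)

  IsMaximalIdeal : Pred → Set (Level.suc (c ⊔ ℓ))
  IsMaximalIdeal M =
    IsIdeal M × (¬ M 1#) ×
    ((J : Pred) → IsIdeal J → M ⊆ J → (J ⊆ M) ⊎ J 1#)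

  ⟨_⟩ : Carrier → Pred
  ⟨ a ⟩ x = Σ[ r ∈ Carrier ] x ≈ a * r

  IsDividedPrime : Pred → Set (c ⊔ ℓ)
  IsDividedPrime P = ∀ a → (P ⊆ ⟨ a ⟩) ⊎ (⟨ a ⟩ ⊆ P)

  IsDivided : Set (Level.suc (c ⊔ ℓ))
  IsDivided = (P : Pred) → IsPrimeIdeal P → IsDividedPrime P

  pow : Carrier → ℕ → Carrier
  pow a zero = 1#
  pow a (suc n) = a * pow a n

-- In a domain, if k ∤ w then k ^ i * w has k-adic valuation exactly i, which the formula
-- "p ∣ z ∧ q ∤ z" with parameters (k ^ j, k ^ (j+1)) detects. If x + y = 1 with x, y
-- non-units, then x ∤ y ^ j and y ∤ x ^ i, so the elements x ^ i * y ^ j have independent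
-- x- and y-valuations and form an ict-pattern of depth 2; hence a dp-minimal domain is
-- local, and 1 - b ^ k is a unit for every non-unit b.
-- If no N made b ∣ a or a ∣ b ^ N for all a, b, take b ∤ a with a ∤ b ^ (2n+1). The elements
-- b ^ (n+i) + b ^ j * a lie in the coset b ^ (n+i') + aR exactly when i' = i (otherwise
-- a ∣ b ^ (n+i) * (1 - b ^ k)), and have b-valuation exactly j because
-- b ∤ b ^ (n+i-j) + a: again an ict-pattern.
-- With such an N every prime P is divided: if a ∉ P and x ∈ P, then x ∣ a ^ N would put a
-- into P, so a ∣ x.

{-# OPTIONS --safe #-}
module Submission where

open import Defs
open import Level using (_⊔_; lift)
open import Algebra.Bundles using (CommutativeRing)
open import Axiom.ExcludedMiddle using (ExcludedMiddle)
open import Axiom.DoubleNegationElimination using (DoubleNegationElimination; em⇒dne)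
open import Data.Nat using (ℕ; zero; suc)
import Data.Nat as ℕ
import Data.Nat.Properties as ℕₚ
open import Data.Fin using (Fin; zero; suc; toℕ)
open import Data.Fin.Properties using (toℕ-injective; toℕ<n)
open import Data.Vec using (Vec; []; _∷_; lookup)
open import Data.Product using (Σ-syntax; _×_; _,_; proj₁; proj₂)
open import Data.Sum using (_⊎_; inj₁; inj₂; [_,_])
import Data.Sum as Sum
open import Data.Empty.Polymorphic using (⊥-elim)
open import Function using (id; _∘_)
open import Function.Bundles using (_⇔_; mk⇔; Equivalence)
import Function.Properties.Equivalence as ⇔
open import Relation.Binary.Definitions using (tri<; tri≈; tri>)
import Relation.Binary.PropositionalEquality as ≡
open import Relation.Binary.PropositionalEquality using (_≡_)
open import Relation.Nullary using (¬_; yes; no; contradiction)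
open import Relation.Nullary.Decidable using (toSum)

_∣ᶠ_ : ∀ {n} → Fin n → Fin n → Formula n
i ∣ᶠ j = `∃ (var (suc j) `≈ (var zero `* var (suc i)))

exactDivᶠ : Formula 3
exactDivᶠ = (suc zero ∣ᶠ zero) `∧ ((suc (suc zero) ∣ᶠ zero) `⇒ `⊥)

cosetᶠ : Formula 3
cosetᶠ = `∃ (var (suc zero) `≈ (var (suc (suc (suc zero))) `+ (var zero `* var (suc (suc zero)))))

≡⇔toℕ≡ : ∀ {n} {i j : Fin n} → (i ≡ j) ⇔ (toℕ i ≡ toℕ j)
≡⇔toℕ≡ = mk⇔ (≡.cong toℕ) toℕ-injective

module CommutativeRingTheory {c ℓ} (R : CommutativeRing c ℓ) where

  open CommutativeRing R hiding (zero)
  open import Algebra.Properties.Ring ring using (x[y-z]≈xy-xz; [y-z]x≈yx-zx)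
  open import Algebra.Properties.AbelianGroup +-abelianGroup using (⁻¹-∙-comm)
  open import Algebra.Properties.Group +-group
    using (//-rightDividesˡ; //-rightDividesʳ; x∙y⁻¹≈ε⇒x≈y; x≈y⇒x∙y⁻¹≈ε)
  open import Algebra.Properties.CommutativeSemigroup +-commutativeSemigroup
    using () renaming (interchange to +-interchange)
  open import Algebra.Properties.CommutativeSemigroup *-commutativeSemigroup
    using (x∙yz≈y∙xz; x∙yz≈z∙xy; xy∙z≈y∙xz)
  open import Algebra.Properties.Semiring.Divisibility semiring
  open import Algebra.Properties.CommutativeSemigroup.Divisibility *-commutativeSemigroup
    using (x∣xy; x∣y⇒zx∣zy)
  open import Relation.Binary.Reasoning.Setoid setoid

  infixr 8 _^_
  _^_ : Carrier → ℕ → Carrier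
  _^_ = pow R

  IsUnit : Carrier → Set (c ⊔ ℓ)
  IsUnit u = u ∣ 1#

  IsLocal : Set (c ⊔ ℓ)
  IsLocal = ∀ x y → x + y ≈ 1# → IsUnit x ⊎ IsUnit y

  ⟨⟩⇒∣ : ∀ {a x} → ⟨_⟩ R a x → a ∣ x
  ⟨⟩⇒∣ {a} (r , x≈ar) = r , trans (*-comm r a) (sym x≈ar)

  ∣⇒⟨⟩ : ∀ {a x} → a ∣ x → ⟨_⟩ R a x
  ∣⇒⟨⟩ {a} (q , qa≈x) = q , trans (sym qa≈x) (*-comm q a)

  powerPair : Carrier → ℕ → Vec Carrier 2
  powerPair k j = k ^ j ∷ k ^ suc j ∷ []

  ExactPower : Carrier → ℕ → Carrier → Set (c ⊔ ℓ)
  ExactPower k j z = k ^ j ∣ z × k ^ suc j ∤ z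

  sat-∣ᶠ : ∀ {n} (i j : Fin n) (ρ : Vec Carrier n) →
           Sat R (i ∣ᶠ j) ρ ⇔ lookup ρ i ∣ lookup ρ j
  sat-∣ᶠ i j ρ = mk⇔ (λ (q , lift y≈qx) → q , sym y≈qx) (λ (q , qx≈y) → q , lift (sym qx≈y))

  sat-exactDivᶠ : ∀ {x p q} → Sat R exactDivᶠ (x ∷ p ∷ q ∷ []) ⇔ (p ∣ x × q ∤ x)
  sat-exactDivᶠ {x} {p} {q} = mk⇔
    (λ (p∣x , q∤x) → to (p∣ᶠx) p∣x , λ q∣x → ⊥-elim (q∤x (from q∣ᶠx q∣x)))
    (λ (p∣x , q∤x) → from p∣ᶠx p∣x , λ q∣x → contradiction (to q∣ᶠx q∣x) q∤x)
    where
    open Equivalence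
    p∣ᶠx : Sat R (suc zero ∣ᶠ zero) (x ∷ p ∷ q ∷ []) ⇔ p ∣ x
    p∣ᶠx = sat-∣ᶠ (suc zero) zero (x ∷ p ∷ q ∷ [])
    q∣ᶠx : Sat R (suc (suc zero) ∣ᶠ zero) (x ∷ p ∷ q ∷ []) ⇔ q ∣ x
    q∣ᶠx = sat-∣ᶠ (suc (suc zero)) zero (x ∷ p ∷ q ∷ [])

  sat-cosetᶠ : ∀ {x a d} → Sat R cosetᶠ (x ∷ a ∷ d ∷ []) ⇔ (Σ[ r ∈ Carrier ] x ≈ d + r * a)
  sat-cosetᶠ = mk⇔ (λ (r , lift e) → r , e) (λ (r , e) → r , lift e)

  ^-homo-* : ∀ x m n → x ^ (m ℕ.+ n) ≈ x ^ m * x ^ n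
  ^-homo-* x zero    n = sym (*-identityˡ _)
  ^-homo-* x (suc m) n = trans (*-congˡ (^-homo-* x m n)) (sym (*-assoc x _ _))

  ^-∣-^ : ∀ x {m n} → m ℕ.≤ n → x ^ m ∣ x ^ n
  ^-∣-^ x {n = n} ℕ.z≤n       = 1∣ (x ^ n)
  ^-∣-^ x         (ℕ.s≤s m≤n) = x∣y⇒zx∣zy x (^-∣-^ x m≤n)

  ∣-+ : ∀ {a x y} → a ∣ x → a ∣ y → a ∣ x + y
  ∣-+ {a} (p , pa≈x) (q , qa≈y) = p + q , trans (distribʳ a p q) (+-cong pa≈x qa≈y)

  ∣x+y∣x⇒∣y : ∀ {a x y} → a ∣ x + y → a ∣ x → a ∣ y
  ∣x+y∣x⇒∣y {a} {x} {y} (q , qa≈x+y) (p , pa≈x) = q - p , (begin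
    (q - p) * a    ≈⟨ [y-z]x≈yx-zx a q p ⟩
    q * a - p * a  ≈⟨ +-cong qa≈x+y (-‿cong pa≈x) ⟩
    (x + y) - x    ≈⟨ +-congʳ (+-comm x y) ⟩
    (y + x) - x    ≈⟨ //-rightDividesʳ x y ⟩
    y              ∎)

  isUnit⇒∣ : ∀ {u x} → IsUnit u → u ∣ x
  isUnit⇒∣ {x = x} u∣1 = ∣ʳ-trans u∣1 (1∣ x)

  ∣*isUnit⇒∣ : ∀ {u a x} → IsUnit u → a ∣ x * u → a ∣ x
  ∣*isUnit⇒∣ {u} {a} {x} (v , vu≈1) a∣xu = ∣ʳ-respʳ-≈ vxu≈x (x∣ʳy⇒x∣ʳzy v a∣xu)
    where
    vxu≈x : v * (x * u) ≈ x
    vxu≈x = begin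
      v * (x * u)  ≈⟨ x∙yz≈y∙xz v x u ⟩
      x * (v * u)  ≈⟨ *-congˡ vu≈1 ⟩
      x * 1#       ≈⟨ *-identityʳ x ⟩
      x            ∎

  isUnit-^⇒isUnit : ∀ {x} k → IsUnit (x ^ suc k) → IsUnit x
  isUnit-^⇒isUnit {x} k = ∣ʳ-trans (x∣xy x (x ^ k))

  comaximal-∣^⇒isUnit : ∀ {x y} → x + y ≈ 1# → ∀ j → x ∣ y ^ j → IsUnit x
  comaximal-∣^⇒isUnit x+y≈1 zero x∣1 = x∣1
  comaximal-∣^⇒isUnit {x} {y} x+y≈1 (suc j) x∣y^[1+j] =
    comaximal-∣^⇒isUnit x+y≈1 j (∣ʳ-respʳ-≈ y^j[x+y]≈y^j (∣-+ (x∣ʳyx x (y ^ j)) x∣y^[1+j]))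
    where
    y^j[x+y]≈y^j : y ^ j * x + y * y ^ j ≈ y ^ j
    y^j[x+y]≈y^j = begin
      y ^ j * x + y * y ^ j    ≈⟨ +-congˡ (*-comm y (y ^ j)) ⟩
      y ^ j * x + y ^ j * y    ≈⟨ distribˡ (y ^ j) x y ⟨
      y ^ j * (x + y)          ≈⟨ *-congˡ x+y≈1 ⟩
      y ^ j * 1#               ≈⟨ *-identityʳ _ ⟩
      y ^ j                    ∎

  ∣-closed : ∀ {I a x} → IsIdeal R I → I a → a ∣ x → I x
  ∣-closed (≈-closed , _ , _ , *-closed) Ia (q , qa≈x) = ≈-closed _ _ qa≈x (*-closed q _ Ia)

  prime-^ : ∀ {P x} → IsPrimeIdeal R P → ∀ n → P (x ^ n) → P x
  prime-^ (_ , P∌1 , _) zero P1 = contradiction P1 P∌1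
  prime-^ {x = x} P-prime@(_ , _ , prime) (suc n) Px^[1+n] =
    [ id , prime-^ P-prime n ] (prime x (x ^ n) Px^[1+n])

  [x+y]-[u+v]≈[x-u]+[y-v] : ∀ x y u v → (x + y) - (u + v) ≈ (x - u) + (y - v)
  [x+y]-[u+v]≈[x-u]+[y-v] x y u v = begin
    (x + y) - (u + v)      ≈⟨ +-congˡ (⁻¹-∙-comm u v) ⟨
    (x + y) + (- u + - v)  ≈⟨ +-interchange x y (- u) (- v) ⟩
    (x - u) + (y - v)      ∎

  coset-∣- : ∀ {a x d d′ r s} → x ≈ d + s * a → x ≈ d′ + r * a → a ∣ d - d′
  coset-∣- {a} {x} {d} {d′} {r} {s} x≈d+sa x≈d′+ra =
    ∣x+y∣x⇒∣y (∣ʳ-respʳ-≈ 0≈[sa-ra]+[d-d′] (a ∣0)) (s - r , [y-z]x≈yx-zx a s r)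
    where
    0≈[sa-ra]+[d-d′] : 0# ≈ (s * a - r * a) + (d - d′)
    0≈[sa-ra]+[d-d′] = begin
      0#                             ≈⟨ -‿inverseʳ x ⟨
      x - x                          ≈⟨ +-cong (trans x≈d+sa (+-comm d _)) (-‿cong (trans x≈d′+ra (+-comm d′ _))) ⟩
      (s * a + d) - (r * a + d′)     ≈⟨ [x+y]-[u+v]≈[x-u]+[y-v] (s * a) d (r * a) d′ ⟩
      (s * a - r * a) + (d - d′)     ∎

  x+y≈1∧y∤1⇒x≉0 : ∀ {x y} → x + y ≈ 1# → ¬ IsUnit y → ¬ x ≈ 0#
  x+y≈1∧y∤1⇒x≉0 {x} {y} x+y≈1 y∤1 x≈0 = y∤1 (∣ʳ-reflexive (begin
    y       ≈⟨ +-identityˡ y ⟨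
    0# + y  ≈⟨ +-congʳ x≈0 ⟨
    x + y   ≈⟨ x+y≈1 ⟩
    1#      ∎))

  module LocalRing (isLocal : IsLocal) where

    1-nonunit-isUnit : ∀ {x} → ¬ IsUnit x → IsUnit (1# - x)
    1-nonunit-isUnit {x} x∤1 =
      [ id , (λ x∣1 → contradiction x∣1 x∤1) ] (isLocal (1# - x) x (//-rightDividesˡ x 1#))

    ∣^-^⇒∣^ : ∀ {a b m n} → ¬ IsUnit b → m ℕ.< n → a ∣ b ^ m - b ^ n → a ∣ b ^ m
    ∣^-^⇒∣^ {a} {b} {m} b∤1 m<n a∣b^m-b^n with ℕₚ.m≤n⇒∃[o]m+o≡n m<n
    ... | k , ≡.refl =
      ∣*isUnit⇒∣ (1-nonunit-isUnit (b∤1 ∘ isUnit-^⇒isUnit k)) (∣ʳ-respʳ-≈ factor a∣b^m-b^n)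
      where
      factor : b ^ m - b ^ suc (m ℕ.+ k) ≈ b ^ m * (1# - b ^ suc k)
      factor = begin
        b ^ m - b * b ^ (m ℕ.+ k)         ≈⟨ +-congˡ (-‿cong (*-congˡ (^-homo-* b m k))) ⟩
        b ^ m - b * (b ^ m * b ^ k)       ≈⟨ +-congˡ (-‿cong (x∙yz≈y∙xz b (b ^ m) (b ^ k))) ⟩
        b ^ m - b ^ m * b ^ suc k         ≈⟨ +-congʳ (*-identityʳ (b ^ m)) ⟨
        b ^ m * 1# - b ^ m * b ^ suc k    ≈⟨ x[y-z]≈xy-xz (b ^ m) 1# (b ^ suc k) ⟨
        b ^ m * (1# - b ^ suc k)          ∎

    power-coset-injective : ∀ {a b x r s N p q} → ¬ IsUnit b → a ∤ b ^ N → p ℕ.≤ N → q ℕ.≤ N →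
                            x ≈ b ^ p + s * a → x ≈ b ^ q + r * a → p ≡ q
    power-coset-injective {b = b} {p = p} {q} b∤1 a∤b^N p≤N q≤N x∈b^p+aR x∈b^q+aR
      with ℕₚ.<-cmp p q
    ... | tri< p<q _ _ = contradiction
      (∣ʳ-trans (∣^-^⇒∣^ b∤1 p<q (coset-∣- x∈b^p+aR x∈b^q+aR)) (^-∣-^ b p≤N)) a∤b^N
    ... | tri≈ _ p≡q _ = p≡q
    ... | tri> _ _ q<p = contradiction
      (∣ʳ-trans (∣^-^⇒∣^ b∤1 q<p (coset-∣- x∈b^q+aR x∈b^p+aR)) (^-∣-^ b q≤N)) a∤b^N

  module IntegralDomain (dom : IsIntegralDomain R) where

    private
      1≉0 : ¬ 1# ≈ 0#
      1≉0 = proj₁ dom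

      zero-divisor : ∀ x y → x * y ≈ 0# → x ≈ 0# ⊎ y ≈ 0#
      zero-divisor = proj₂ dom

    *-cancelˡ-≉0 : ∀ {k x y} → ¬ k ≈ 0# → k * x ≈ k * y → x ≈ y
    *-cancelˡ-≉0 {k} {x} {y} k≉0 kx≈ky =
      [ (λ k≈0 → contradiction k≈0 k≉0) , x∙y⁻¹≈ε⇒x≈y x y ]
      (zero-divisor k (x - y) (trans (x[y-z]≈xy-xz k x y) (x≈y⇒x∙y⁻¹≈ε kx≈ky)))

    ^-≉0 : ∀ {k} → ¬ k ≈ 0# → ∀ n → ¬ k ^ n ≈ 0#
    ^-≉0 k≉0 zero    = 1≉0
    ^-≉0 k≉0 (suc n) = [ k≉0 , ^-≉0 k≉0 n ] ∘ zero-divisor _ _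

    k^j∣k^i*w⇔j≤i : ∀ {k w} → ¬ k ≈ 0# → k ∤ w → ∀ i j → k ^ j ∣ k ^ i * w ⇔ j ℕ.≤ i
    k^j∣k^i*w⇔j≤i {k} {w} k≉0 k∤w i j = mk⇔
      (λ k^j∣k^iw → ℕₚ.≮⇒≥ λ i<j → k∤w (k^[1+i]∣k^iw⇒k∣w (∣ʳ-trans (^-∣-^ k i<j) k^j∣k^iw)))
      (λ j≤i → ∣ʳ-trans (^-∣-^ k j≤i) (x∣xy (k ^ i) w))
      where
      k^[1+i]∣k^iw⇒k∣w : k ^ suc i ∣ k ^ i * w → k ∣ w
      k^[1+i]∣k^iw⇒k∣w (q , q[kk^i]≈k^iw) =
        q , *-cancelˡ-≉0 (^-≉0 k≉0 i) (trans (sym (x∙yz≈z∙xy q k (k ^ i))) q[kk^i]≈k^iw)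

    exactPower⇔≡ : ∀ {k w z i} → ¬ k ≈ 0# → k ∤ w → z ≈ k ^ i * w → ∀ j → ExactPower k j z ⇔ j ≡ i
    exactPower⇔≡ {k} {w} {z} {i} k≉0 k∤w z≈k^iw j = mk⇔
      (λ (k^j∣z , k^[1+j]∤z) → ℕₚ.≤∧≮⇒≡ (≤i k^j∣z) (k^[1+j]∤z ∘ ∣z))
      (λ { ≡.refl → ∣z ℕₚ.≤-refl , ℕₚ.<-irrefl ≡.refl ∘ ≤i })
      where
      ≤i : ∀ {j} → k ^ j ∣ z → j ℕ.≤ i
      ≤i = Equivalence.to (k^j∣k^i*w⇔j≤i k≉0 k∤w i _) ∘ ∣ʳ-respʳ-≈ z≈k^iw
      ∣z : ∀ {j} → j ℕ.≤ i → k ^ j ∣ z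
      ∣z = ∣ʳ-respʳ-≈ (sym z≈k^iw) ∘ Equivalence.from (k^j∣k^i*w⇔j≤i k≉0 k∤w i _)

    sat-exactDivᶠ-powerPair : ∀ {n k w z} {i : Fin n} → ¬ k ≈ 0# → k ∤ w → z ≈ k ^ toℕ i * w →
                               ∀ j → Sat R exactDivᶠ (z ∷ powerPair k (toℕ j)) ⇔ j ≡ i
    sat-exactDivᶠ-powerPair k≉0 k∤w z≈k^iw j =
      ⇔.trans sat-exactDivᶠ (⇔.trans (exactPower⇔≡ k≉0 k∤w z≈k^iw (toℕ j)) (⇔.sym ≡⇔toℕ≡))

    comaximal-nonunits⇒ict : ∀ {x y} → x + y ≈ 1# → ¬ IsUnit x → ¬ IsUnit y → ICTPattern2 R
    comaximal-nonunits⇒ict {x} {y} x+y≈1 x∤1 y∤1 = 2 , 2 , exactDivᶠ , exactDivᶠ , λ n →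
      (λ i → powerPair x (toℕ i)) , (λ j → powerPair y (toℕ j)) , λ i j →
      x ^ toℕ i * y ^ toℕ j ,
      sat-exactDivᶠ-powerPair (x+y≈1∧y∤1⇒x≉0 x+y≈1 y∤1)
        (x∤1 ∘ comaximal-∣^⇒isUnit x+y≈1 (toℕ j)) refl ,
      sat-exactDivᶠ-powerPair (x+y≈1∧y∤1⇒x≉0 y+x≈1 x∤1)
        (y∤1 ∘ comaximal-∣^⇒isUnit y+x≈1 (toℕ i)) (*-comm _ _)
      where
      y+x≈1 : y + x ≈ 1#
      y+x≈1 = trans (+-comm y x) x+y≈1

    module UnboundedPattern (isLocal : IsLocal) (n : ℕ) {a b : Carrier}
                            (b∤a : b ∤ a) (a∤b^[1+2n] : a ∤ b ^ suc (n ℕ.+ n)) where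

      open LocalRing isLocal

      z : Fin n → Fin n → Carrier
      z i j = b ^ (n ℕ.+ toℕ i) + b ^ toℕ j * a

      n+i≤1+2n : ∀ (i : Fin n) → n ℕ.+ toℕ i ℕ.≤ suc (n ℕ.+ n)
      n+i≤1+2n i = ℕₚ.m≤n⇒m≤1+n (ℕₚ.+-monoʳ-≤ n (ℕₚ.<⇒≤ (toℕ<n i)))

      sat-cosetᶠ-z : ∀ i j i′ → Sat R cosetᶠ (z i j ∷ a ∷ b ^ (n ℕ.+ toℕ i′) ∷ []) ⇔ i′ ≡ i
      sat-cosetᶠ-z i j i′ = ⇔.trans sat-cosetᶠ (mk⇔
        (λ (r , z∈b^[n+i′]+aR) → toℕ-injective (ℕₚ.+-cancelˡ-≡ n _ _
          (power-coset-injective (b∤a ∘ isUnit⇒∣) a∤b^[1+2n] (n+i≤1+2n i′) (n+i≤1+2n i)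
            z∈b^[n+i′]+aR refl)))
        (λ { ≡.refl → b ^ toℕ j , refl }))

      sat-exactDivᶠ-z : ∀ i j j′ → Sat R exactDivᶠ (z i j ∷ powerPair b (toℕ j′)) ⇔ j′ ≡ j
      sat-exactDivᶠ-z i j with ℕₚ.m≤n⇒∃[o]m+o≡n (ℕₚ.≤-trans (toℕ<n j) (ℕₚ.m≤m+n n (toℕ i)))
      ... | o , 1+j+o≡n+i = sat-exactDivᶠ-powerPair b≉0 b∤w z≈b^jw
        where
        w : Carrier
        w = b * b ^ o + a

        b≉0 : ¬ b ≈ 0#
        b≉0 b≈0 = a∤b^[1+2n] (∣ʳ-respʳ-≈ (sym (trans (*-congʳ b≈0) (zeroˡ _))) (a ∣0))

        b∤w : b ∤ w
        b∤w b∣w = b∤a (∣x+y∣x⇒∣y b∣w (x∣xy b (b ^ o)))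

        z≈b^jw : z i j ≈ b ^ toℕ j * w
        z≈b^jw = begin
          b ^ (n ℕ.+ toℕ i) + b ^ toℕ j * a        ≈⟨ +-congʳ (reflexive (≡.cong (b ^_) 1+j+o≡n+i)) ⟨
          b ^ (suc (toℕ j) ℕ.+ o) + b ^ toℕ j * a  ≈⟨ +-congʳ (^-homo-* b (suc (toℕ j)) o) ⟩
          b * b ^ toℕ j * b ^ o + b ^ toℕ j * a    ≈⟨ +-congʳ (xy∙z≈y∙xz b (b ^ toℕ j) (b ^ o)) ⟩
          b ^ toℕ j * (b * b ^ o) + b ^ toℕ j * a  ≈⟨ distribˡ (b ^ toℕ j) (b * b ^ o) a ⟨
          b ^ toℕ j * w                             ∎

    unbounded⇒ict : IsLocal → (∀ N → Σ[ a ∈ Carrier ] Σ[ b ∈ Carrier ] (b ∤ a × a ∤ b ^ N)) →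
                    ICTPattern2 R
    unbounded⇒ict isLocal counterexample = 2 , 2 , cosetᶠ , exactDivᶠ , λ n →
      let (a , b , b∤a , a∤b^[1+2n]) = counterexample (suc (n ℕ.+ n))
          open UnboundedPattern isLocal n b∤a a∤b^[1+2n]
      in (λ i → a ∷ b ^ (n ℕ.+ toℕ i) ∷ []) , (λ j → powerPair b (toℕ j)) ,
         λ i j → z i j , sat-cosetᶠ-z i j , sat-exactDivᶠ-z i j

    module DpMinimalDomain (lem : ExcludedMiddle (c ⊔ ℓ)) (dpm : DpMinimal R) where

      private
        dne : DoubleNegationElimination (c ⊔ ℓ)
        dne = em⇒dne lem

      isLocal : IsLocal
      isLocal x y x+y≈1 with lem {IsUnit x} | lem {IsUnit y}
      ... | yes x∣1 | _       = inj₁ x∣1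
      ... | no _    | yes y∣1 = inj₂ y∣1
      ... | no x∤1  | no y∤1  = contradiction (comaximal-nonunits⇒ict x+y≈1 x∤1 y∤1) dpm

      DivisibilityBound : ℕ → Set (c ⊔ ℓ)
      DivisibilityBound N = ∀ a b → b ∣ a ⊎ a ∣ b ^ N

      unbounded⇒counterexample : ∀ N → ¬ DivisibilityBound N →
                                 Σ[ a ∈ Carrier ] Σ[ b ∈ Carrier ] (b ∤ a × a ∤ b ^ N)
      unbounded⇒counterexample N unbounded = dne λ no-counterexample → unbounded λ a b →
        [ inj₁ , (λ b∤a → inj₂ (dne λ a∤b^N → no-counterexample (a , b , b∤a , a∤b^N))) ] (toSum lem)

      divisibilityBound : Σ[ N ∈ ℕ ] DivisibilityBound N
      divisibilityBound = dne λ unbounded →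
        dpm (unbounded⇒ict isLocal λ N → unbounded⇒counterexample N (unbounded ∘ (N ,_)))

      N : ℕ
      N = proj₁ divisibilityBound

      bound : DivisibilityBound N
      bound = proj₂ divisibilityBound

      isDivided : IsDivided R
      isDivided P P-prime@(P-ideal , _) a = Sum.swap (Sum.map ⟨a⟩⊆P P⊆⟨a⟩ (toSum lem))
        where
        ⟨a⟩⊆P : P a → _⊆_ R (⟨_⟩ R a) P
        ⟨a⟩⊆P Pa x a∣x = ∣-closed P-ideal Pa (⟨⟩⇒∣ a∣x)

        P⊆⟨a⟩ : ¬ P a → _⊆_ R P (⟨_⟩ R a)
        P⊆⟨a⟩ P∌a x Px = [ ∣⇒⟨⟩ , (λ x∣a^N → contradiction (Pa x∣a^N) P∌a) ] (bound x a)
          where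
          Pa : x ∣ a ^ N → P a
          Pa = prime-^ P-prime N ∘ ∣-closed P-ideal Px

theorem3p9 : ∀ {c ℓ} → ExcludedMiddle (c ⊔ ℓ) → (R : CommutativeRing c ℓ) →
    IsIntegralDomain R → DpMinimal R →
    IsDivided R ×
    ((M : Pred R) → IsMaximalIdeal R M →
      Σ[ N ∈ ℕ ] (∀ a b → M a → M b → ⟨_⟩ R b a ⊎ ⟨_⟩ R a (pow R b N)))
theorem3p9 lem R dom dpm = isDivided , λ _ _ → N , λ a b _ _ → Sum.map ∣⇒⟨⟩ ∣⇒⟨⟩ (bound a b)
  where
  open CommutativeRingTheory R
  open IntegralDomain dom
  open DpMinimalDomain lem dpm
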